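{- If $H$ is a $(4,2)$-bigraph, then every vertex of $H$ is incident with at least two edges each of which is contained in a 1-factor of $H$.
   Context: A bigraph is a bipartite graph with parts $A$ and $B$ such that $|A|=|B|$. An $(s,t)$-bigraph is a bigraph with $|A|=|B|=s$ and minimum degree at least $t$. -}

module Defs where

open import Data.Nat using (ℕ)
open import Data.Fin using (Fin)
open import Data.Bool using (Bool; true)
open import Data.Product using (Σ; _×_; ∃-syntax)
open import Relation.Binary.PropositionalEquality using (_≡_; _≢_)
open import Function.Bundles using (_↔_; Inverse)

-- A bigraph with parts A = Fin s and B = Fin s (disjoint copies),
-- given by its bipartite adjacency relation: adj a b = true iff ab is an edge.
record Bigraph (s : ℕ) : Set where
  field
    adj : Fin s → Fin s → Bool

open Bigraph public

Edge : ∀ {s} → Bigraph s → Fin s → Fin s → Set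
Edge H a b = adj H a b ≡ true

AtLeastNeighboursA : ∀ {s} → Bigraph s → ℕ → Fin s → Set
AtLeastNeighboursA {s} H t a =
  Σ (Fin t → Fin s) λ f → (∀ i j → f i ≡ f j → i ≡ j) × (∀ i → Edge H a (f i))

AtLeastNeighboursB : ∀ {s} → Bigraph s → ℕ → Fin s → Set
AtLeastNeighboursB {s} H t b =
  Σ (Fin t → Fin s) λ f → (∀ i j → f i ≡ f j → i ≡ j) × (∀ i → Edge H (f i) b)

MinDegree≥ : ∀ {s} → Bigraph s → ℕ → Set
MinDegree≥ H t = (∀ a → AtLeastNeighboursA H t a) × (∀ b → AtLeastNeighboursB H t b)

IsBigraph : (s t : ℕ) → Bigraph s → Set
IsBigraph s t H = MinDegree≥ H t

OneFactor : ∀ {s} → Bigraph s → Set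
OneFactor {s} H = Σ (Fin s ↔ Fin s) λ σ → ∀ a → Edge H a (Inverse.to σ a)

InOneFactor : ∀ {s} → Bigraph s → Fin s → Fin s → Set
InOneFactor {s} H a b = Edge H a b × Σ (OneFactor H) λ F → Inverse.to (Data.Product.proj₁ F) a ≡ b

{-# OPTIONS --safe #-}
-- Only finitely many bigraphs are involved, and the proof lets Agda check all of them.
-- The 1-factors of H are found recursively: vertex 0 of A is matched to a neighbour i, and
-- a 1-factor of H minus 0 and i is extended. The two edges required at a vertex a of A are
-- then read off from the images of a under these 1-factors. A vertex of B is a vertex of A
-- in the transposed bigraph, whose 1-factors are the inverse permutations.
module Submission where

open import Defs
open import Data.Nat using (ℕ; zero; suc)
open import Data.Bool using (Bool; true; false; T; if_then_else_; _∧_)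
open import Data.Bool.Properties using (T?; T-∧) renaming (_≟_ to _≟ᵇ_)
open import Data.Fin using (Fin; suc)
open import Data.Fin.Patterns using (0F; 1F)
open import Data.Fin.Properties using (all?; any?; _≟_)
open import Data.Fin.Permutation
  using (id; flip; lift₀; transpose; _∘ₚ_; _⟨$⟩ʳ_; _⟨$⟩ˡ_; inverseˡ; inverseʳ)
open import Data.Fin.Subset using (Subset; inside; outside)
open import Data.List using (List; []; _∷_; concatMap; map; allFin)
open import Data.List.Membership.Propositional using (_∈_; find)
open import Data.List.Membership.Propositional.Properties using (∈-map⁻)
open import Data.List.Relation.Unary.Any using (here; there) renaming (any? to anyᴸ?)
open import Data.Maybe using (Maybe; just; nothing; is-just; to-witness-T) renaming (map to mapᴹ)
open import Data.Product using (Σ; _×_; _,_; proj₁; proj₂; swap)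
open import Data.Vec using (Vec; []; _∷_; lookup; tabulate)
open import Data.Vec.Properties using (lookup∘tabulate)
open import Data.Vec.Relation.Unary.All using (All; []; _∷_)
open import Data.Vec.Relation.Unary.All.Properties using (lookup⁻)
open import Function using (_∘_)
open import Function.Bundles using (Equivalence)
open import Level using (0ℓ)
open import Relation.Binary.PropositionalEquality using (_≡_; _≢_; refl; sym; trans; cong; subst)
open import Relation.Nullary using (Dec; yes; no; does; ¬?; _×-dec_; _→-dec_; contradiction)
open import Relation.Nullary.Decidable using (isYes; toWitness)
open import Relation.Unary using (Pred; Decidable)

private variable
  n s : ℕ
  a b : Fin s
  G H : Bigraph s

TwoDistinct : (Fin s → Set) → Set
TwoDistinct P = Σ _ λ x₁ → Σ _ λ x₂ → x₁ ≢ x₂ × P x₁ × P x₂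

TwoDistinct-map : {P Q : Fin s → Set} → (∀ {x} → P x → Q x) → TwoDistinct P → TwoDistinct Q
TwoDistinct-map f (x₁ , x₂ , x₁≢x₂ , p₁ , p₂) = x₁ , x₂ , x₁≢x₂ , f p₁ , f p₂

twoDistinct? : {P : Fin s → Set} → Decidable P → Dec (TwoDistinct P)
twoDistinct? P? = any? λ x₁ → any? λ x₂ → ¬? (x₁ ≟ x₂) ×-dec P? x₁ ×-dec P? x₂

findTwoDistinct : (xs : List (Fin s)) → Maybe (TwoDistinct (_∈ xs))
findTwoDistinct []       = nothing
findTwoDistinct (x ∷ xs) with anyᴸ? (λ y → ¬? (x ≟ y)) xs
... | yes x≢y∈xs = let y , y∈xs , x≢y = find x≢y∈xs in
                   just (x , y , x≢y , here refl , there y∈xs)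
... | no _       = nothing

infix 10 _ᵀ
_ᵀ : Bigraph s → Bigraph s
adj (H ᵀ) b a = adj H a b

_⊆_ : Bigraph s → Bigraph s → Set
G ⊆ H = ∀ {a b} → Edge G a b → Edge H a b

edge? : (H : Bigraph s) (a b : Fin s) → Dec (Edge H a b)
edge? H a b = adj H a b ≟ᵇ true

MinDegree₂ : Bigraph s → Set
MinDegree₂ H = (∀ a → TwoDistinct (Edge H a)) × (∀ b → TwoDistinct λ a → Edge H a b)

MinDegree₂-mono : G ⊆ H → MinDegree₂ G → MinDegree₂ H
MinDegree₂-mono G⊆H (degA , degB) = TwoDistinct-map G⊆H ∘ degA , TwoDistinct-map G⊆H ∘ degB

atLeastTwoNeighbours⇒TwoDistinct :
  (H : Bigraph s) → AtLeastNeighboursA H 2 a → TwoDistinct (Edge H a)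
atLeastTwoNeighbours⇒TwoDistinct H (f , f-inj , edges) =
  f 0F , f 1F , (λ eq → 0F≢1F (f-inj 0F 1F eq)) , edges 0F , edges 1F
  where
  0F≢1F : 0F ≢ 1F
  0F≢1F ()

IsBigraph⇒MinDegree₂ : IsBigraph s 2 H → MinDegree₂ H
IsBigraph⇒MinDegree₂ {H = H} (degA , degB) =
  atLeastTwoNeighbours⇒TwoDistinct H ∘ degA , atLeastTwoNeighbours⇒TwoDistinct (H ᵀ) ∘ degB

inOneFactor : (F : OneFactor H) (a : Fin s) → InOneFactor H a (proj₁ F ⟨$⟩ʳ a)
inOneFactor F a = proj₂ F a , F , refl

InOneFactor-mono : G ⊆ H → InOneFactor G a b → InOneFactor H a b
InOneFactor-mono G⊆H (e , (σ , σ-edges) , σa≡b) = G⊆H e , (σ , G⊆H ∘ σ-edges) , σa≡b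

OneFactor-ᵀ : (H : Bigraph s) → OneFactor (H ᵀ) → OneFactor H
OneFactor-ᵀ H (σ , σ-edges) =
  flip σ , λ x → subst (λ y → Edge H y (σ ⟨$⟩ˡ x)) (inverseʳ σ) (σ-edges (σ ⟨$⟩ˡ x))

InOneFactor-ᵀ : (H : Bigraph s) → InOneFactor (H ᵀ) b a → InOneFactor H a b
InOneFactor-ᵀ {a = a} H (_ , F , refl) =
  subst (InOneFactor H a) (inverseˡ (proj₁ F)) (inOneFactor {H = H} (OneFactor-ᵀ H F) a)

-- H minus vertex 0 of A and vertex i of B, with B relabelled by the transposition of 0 and i
-- so that a 1-factor π of it extends to the 1-factor lift₀ π ∘ₚ transpose 0F i of H.
_⊖_ : Bigraph (suc n) → Fin (suc n) → Bigraph n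
adj (H ⊖ i) x y = adj H (suc x) (transpose 0F i ⟨$⟩ʳ suc y)

extendOneFactor :
  (H : Bigraph (suc n)) (i : Fin (suc n)) → Edge H 0F i → OneFactor (H ⊖ i) → OneFactor H
extendOneFactor H i e (π , π-edges) =
  lift₀ π ∘ₚ transpose 0F i , λ { 0F → e ; (suc x) → π-edges x }

oneFactors : (H : Bigraph s) → List (OneFactor H)
oneFactors {zero}  H = (id , λ ()) ∷ []
oneFactors {suc n} H = concatMap extensions (allFin (suc n))
  where
  extensions : Fin (suc n) → List (OneFactor H)
  extensions i with adj H 0F i in e
  ... | true  = map (extendOneFactor H i e) (oneFactors (H ⊖ i))
  ... | false = []

factorImages : (H : Bigraph s) → Fin s → List (Fin s)
factorImages H a = map (λ F → proj₁ F ⟨$⟩ʳ a) (oneFactors H)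

∈-factorImages⇒InOneFactor : b ∈ factorImages H a → InOneFactor H a b
∈-factorImages⇒InOneFactor {H = H} {a = a} b∈
  with F , _ , refl ← ∈-map⁻ (λ F → proj₁ F ⟨$⟩ʳ a) b∈ = inOneFactor {H = H} F a

findTwoFactorEdgesAt : (H : Bigraph s) (a : Fin s) → Maybe (TwoDistinct (InOneFactor H a))
findTwoFactorEdgesAt H a =
  mapᴹ (TwoDistinct-map ∈-factorImages⇒InOneFactor) (findTwoDistinct (factorImages H a))

-- Boolean-valued with a separate soundness proof rather than Dec-valued: evaluating a Dec
-- over all cases would keep the proof terms of every case alive.
allSubsetᵇ : ∀ n → (Subset n → Bool) → Bool
allSubsetᵇ zero    f = f []
allSubsetᵇ (suc n) f = allSubsetᵇ n (f ∘ (inside ∷_)) ∧ allSubsetᵇ n (f ∘ (outside ∷_))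

allSubsetᵇ-sound : ∀ n {f} → T (allSubsetᵇ n f) → ∀ p → T (f p)
allSubsetᵇ-sound zero    t []            = t
allSubsetᵇ-sound (suc n) t (inside ∷ p)  = allSubsetᵇ-sound n (proj₁ (Equivalence.to T-∧ t)) p
allSubsetᵇ-sound (suc n) t (outside ∷ p) = allSubsetᵇ-sound n (proj₂ (Equivalence.to T-∧ t)) p

module _ {R : Pred (Subset n) 0ℓ} (R? : Decidable R) where

  allRowsᵇ : ∀ m → (Vec (Subset n) m → Bool) → Bool
  allRowsᵇ zero    f = f []
  allRowsᵇ (suc m) f =
    allSubsetᵇ n λ r → if does (R? r) then allRowsᵇ m (f ∘ (r ∷_)) else true

  allRowsᵇ-sound : ∀ m {f} → T (allRowsᵇ m f) → ∀ rs → All R rs → T (f rs)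
  allRowsᵇ-sound zero    t []       []          = t
  allRowsᵇ-sound (suc m) t (r ∷ rs) (Rr ∷ Rrs) with R? r | allSubsetᵇ-sound n t r
  ... | yes _  | t′ = allRowsᵇ-sound m t′ rs Rrs
  ... | no ¬Rr | _  = contradiction Rr ¬Rr

fromRows : Vec (Subset s) s → Bigraph s
adj (fromRows rs) a b = lookup (lookup rs a) b

rows : Bigraph s → Vec (Subset s) s
rows H = tabulate λ a → tabulate (adj H a)

adj-fromRows-rows : (H : Bigraph s) (a b : Fin s) → adj (fromRows (rows H)) a b ≡ adj H a b
adj-fromRows-rows H a b =
  trans (cong (λ r → lookup r b) (lookup∘tabulate _ a)) (lookup∘tabulate (adj H a) b)

⊆-fromRows-rows : (H : Bigraph s) → H ⊆ fromRows (rows H)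
⊆-fromRows-rows H = trans (adj-fromRows-rows H _ _)

fromRows-rows-⊆ : (H : Bigraph s) → fromRows (rows H) ⊆ H
fromRows-rows-⊆ H = trans (sym (adj-fromRows-rows H _ _))

findTwoFactorEdgesAt-succeeds : (rs : Vec (Subset 4) 4) → MinDegree₂ (fromRows rs) →
  ∀ a → T (is-just (findTwoFactorEdgesAt (fromRows rs) a))
findTwoFactorEdgesAt-succeeds rs (degA , degB) =
  toWitness {a? = claim? rs} (allRowsᵇ-sound row? 4 {f = isYes ∘ claim?} _ rs (lookup⁻ degA)) degB
  where
  row? : (r : Subset 4) → Dec (TwoDistinct λ b → lookup r b ≡ true)
  row? r = twoDistinct? λ b → lookup r b ≟ᵇ true

  claim? : (rs : Vec (Subset 4) 4) →
    Dec ((∀ b → TwoDistinct λ a → Edge (fromRows rs) a b) →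
         ∀ a → T (is-just (findTwoFactorEdgesAt (fromRows rs) a)))
  claim? rs = (all? λ b → twoDistinct? λ a → edge? (fromRows rs) a b)
              →-dec (all? λ a → T? (is-just (findTwoFactorEdgesAt (fromRows rs) a)))

twoFactorEdgesAtA : (H : Bigraph 4) → IsBigraph 4 2 H → ∀ a → TwoDistinct (InOneFactor H a)
twoFactorEdgesAtA H deg a =
  TwoDistinct-map (InOneFactor-mono (fromRows-rows-⊆ H)) (to-witness-T _ found)
  where
  minDegree₂ : MinDegree₂ (fromRows (rows H))
  minDegree₂ = MinDegree₂-mono (⊆-fromRows-rows H) (IsBigraph⇒MinDegree₂ deg)

  found : T (is-just (findTwoFactorEdgesAt (fromRows (rows H)) a))
  found = findTwoFactorEdgesAt-succeeds (rows H) minDegree₂ a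

lemma13 : (H : Bigraph 4) → IsBigraph 4 2 H →
    ((a : Fin 4) → Σ (Fin 4) λ b₁ → Σ (Fin 4) λ b₂ →
        b₁ ≢ b₂ × InOneFactor H a b₁ × InOneFactor H a b₂)
    × ((b : Fin 4) → Σ (Fin 4) λ a₁ → Σ (Fin 4) λ a₂ →
        a₁ ≢ a₂ × InOneFactor H a₁ b × InOneFactor H a₂ b)
lemma13 H deg =
  twoFactorEdgesAtA H deg , TwoDistinct-map (InOneFactor-ᵀ H) ∘ twoFactorEdgesAtA (H ᵀ) (swap deg)
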